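{- Let $N,r$ be positive integers and $2\leq j\leq r-1$, and arrange the indices of $E^{(j)}_{N,r}$ (elements of $S_{N,r}$) in lexicographically decreasing order. Then $E^{(j)}_{N,r}$ is block diagonal: $$E^{(j)}_{N,r}=\operatorname{diag}\big(E^{(j)}_{3r-3,r-1},E^{(j)}_{3r-1,r-1},\dots,E^{(j)}_{N-3,r-1}\big),$$ the block $E^{(j)}_{k,r-1}$ corresponding to the indices $(n_1,\dots,n_r)$ with $n_1=N-k$.
   Context: $S_{N,r}=\{(n_1,\dots,n_r)\in\mathbb Z^r: n_1+\dots+n_r=N,\ n_i\geq 3\text{ odd}\}$. For $f$ a polynomial in one variable and $g$ in $r-1$ variables, $(f\circ g)(x_1,\dots,x_r)=f(x_1)g(x_2,\dots,x_r)+\sum_{i=1}^{r-1}\big(f(x_{i+1}-x_i)g(x_1,\dots,\widehat{x_{i+1}},\dots,x_r)-(-1)^{\deg f}f(x_i-x_{i+1})g(x_1,\dots,\widehat{x_i},\dots,x_r)\big)$ (hats denote omission). For integers $m_i,n_i\ge1$, $e\binom{m_1,\dots,m_r}{n_1,\dots,n_r}$ is the coefficient of $x_1^{n_1-1}\cdots x_r^{n_r-1}$ in $x_1^{m_1-1}\circ(x_1^{m_2-1}\cdots x_{r-1}^{m_r-1})$. For $2\le j\le r$, $E^{(j)}_{N,r}$ is the $S_{N,r}\times S_{N,r}$ matrix with $(m,n)$ entry $\delta_{(m_1,\dots,m_{r-j}),(n_1,\dots,n_{r-j})}\,e\binom{m_{r-j+1},\dots,m_r}{n_{r-j+1},\dots,n_r}$,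 where $\delta$ is the Kronecker delta (equal to $1$ iff the tuples coincide). -}

module Defs where

open import Data.Nat as ℕ using (ℕ; zero; suc; _∸_; _≤_)
open import Data.Nat.Properties using (m∸n+n≡m)
import Data.Nat.Properties as ℕP
open import Data.Integer as ℤ using (ℤ; +_; -_)
open import Data.Fin using (Fin; zero; suc; inject₁)
open import Data.Vec as V using (Vec; []; _∷_; insertAt; cast; take; drop; replicate; updateAt; zipWith; allFin)
open import Data.Vec.Properties using (≡-dec)
open import Data.List as L using (List; []; _∷_; _++_; concatMap; map; foldr)
open import Data.List.Relation.Unary.All using (All)
open import Data.Product using (_×_; _,_; ∃)
open import Relation.Binary.PropositionalEquality using (_≡_; sym)
open import Relation.Nullary.Decidable using (does)
open import Data.Bool using (if_then_else_)

-- Polynomials in n variables x₀,…,x_{n-1} (0-based; x₀ is the paper's x₁)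
-- with integer coefficients, as finite lists of monomials
-- (coefficient, exponent vector).  Repeated exponents are allowed; the
-- coefficient of a monomial is the sum over all matching entries.

Poly : ℕ → Set
Poly n = List (ℤ × Vec ℕ n)

coeff : ∀ {n} → Poly n → Vec ℕ n → ℤ
coeff p e = foldr (λ { (c , e') acc → if does (≡-dec ℕ._≟_ e' e) then c ℤ.+ acc else acc })
                  (+ 0) p

_+P_ : ∀ {n} → Poly n → Poly n → Poly n
p +P q = p ++ q

negP : ∀ {n} → Poly n → Poly n
negP = map (λ { (c , e) → (- c , e) })

_-P_ : ∀ {n} → Poly n → Poly n → Poly n
p -P q = p +P negP q

scaleP : ∀ {n} → ℤ → Poly n → Poly n
scaleP a = map (λ { (c , e) → (a ℤ.* c , e) })

_*P_ : ∀ {n} → Poly n → Poly n → Poly n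
p *P q = concatMap (λ { (c , e) → map (λ { (c' , e') → (c ℤ.* c' , zipWith ℕ._+_ e e') }) q }) p

oneP : ∀ {n} → Poly n
oneP = (+ 1 , replicate _ 0) ∷ []

_^P_ : ∀ {n} → Poly n → ℕ → Poly n
p ^P zero  = oneP
p ^P suc k = p *P (p ^P k)

var : ∀ {n} → Fin n → Poly n
var i = (+ 1 , updateAt (replicate _ 0) i (λ _ → 1)) ∷ []

monoP : ∀ {n} → Vec ℕ n → Poly n
monoP a = (+ 1 , a) ∷ []

-- g(x₀,…, x̂_i ,…,x_n) : view g in n variables as a polynomial in n+1
-- variables not involving x_i
omitVar : ∀ {n} → Fin (suc n) → Poly n → Poly (suc n)
omitVar i = map (λ { (c , e) → (c , insertAt e i 0) })

sumP : ∀ {n} → List (Poly n) → Poly n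
sumP = foldr _+P_ []

-- The operation f ∘ g for f = x^d (a monomial of degree d, the only case
-- used in the definition of e) and g a polynomial in n variables; the
-- result is a polynomial in n+1 variables:
-- f(x₁)g(x₂..) + Σ_i ( f(x_{i+1}-x_i) g(..x̂_{i+1}..) - (-1)^d f(x_i-x_{i+1}) g(..x̂_i..) )
-- (written 1-based as in the paper; in code index i ranges over Fin n,
-- x_i ↦ inject₁ i, x_{i+1} ↦ suc i).

circMono : ∀ {n} → ℕ → Poly n → Poly (suc n)
circMono {n} d g =
  ((var zero ^P d) *P omitVar zero g)
  +P sumP (L.map term (V.toList (allFin n)))
  where
  term : Fin n → Poly (suc n)
  term i =
    (((var (suc i) -P var (inject₁ i)) ^P d) *P omitVar (suc i) g)
    -P scaleP ((- (+ 1)) ℤ.^ d)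
              (((var (inject₁ i) -P var (suc i)) ^P d) *P omitVar (inject₁ i) g)

-- e(m₁..m_r ; n₁..n_r) = coefficient of x₁^{n₁-1}⋯x_r^{n_r-1} in
-- x₁^{m₁-1} ∘ (x₁^{m₂-1}⋯x_{r-1}^{m_r-1}).  (For r = 0 the symbol is
-- not defined in the paper; we set it to 0, this case is never used.)

eSym : ∀ {r} → Vec ℕ r → Vec ℕ r → ℤ
eSym [] [] = + 0
eSym (m₁ ∷ ms) ns =
  coeff (circMono (m₁ ∸ 1) (monoP (V.map (_∸ 1) ms))) (V.map (_∸ 1) ns)

Odd : ℕ → Set
Odd k = ∃ λ t → k ≡ suc (2 ℕ.* t)

InS : (N r : ℕ) → Vec ℕ r → Set
InS N r v = V.sum v ≡ N × All (λ x → 3 ≤ x × Odd x) (V.toList v)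

-- Entry (m,n) of E^{(j)}_{N,r} (it does not depend on N, which only
-- determines the index set S_{N,r}):
-- δ_{(m₁..m_{r-j}),(n₁..n_{r-j})} · e(m_{r-j+1}..m_r ; n_{r-j+1}..n_r).

Eent : (j r : ℕ) → j ≤ r → Vec ℕ r → Vec ℕ r → ℤ
Eent j r j≤r m n =
  (if does (≡-dec ℕ._≟_ (take (r ∸ j) m') (take (r ∸ j) n')) then + 1 else + 0)
  ℤ.* eSym (drop (r ∸ j) m') (drop (r ∸ j) n')
  where
  eq : r ≡ r ∸ j ℕ.+ j
  eq = sym (m∸n+n≡m j≤r)
  m' = cast eq m
  n' = cast eq n

module Submission where

-- For j ≤ r-1 the split point r ∸ j of the entry formula is ≥ 1, so the
-- first coordinate always lies in the Kronecker-delta part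
-- δ_{(m₁..m_{r-j}),(n₁..n_{r-j})}, while the e-symbol only sees the last
-- j coordinates.  Hence:
--   * if m₁ ≠ n₁ the delta vanishes and so does the entry;
--   * if m₁ = n₁ the delta on (m₁..m_{r-j}) equals the delta on
--     (m₂..m_{r-j}), and the entry is the entry of E^{(j)} in r-1
--     variables on the tails; the tails lie in S_{N-m₁,r-1}.

open import Defs
open import Data.Nat using (ℕ; suc; _≤_; _∸_)
open import Data.Nat.Properties using (m≤n⇒m≤1+n)
open import Data.Integer using (ℤ; +_)
open import Data.Vec using (Vec; head; tail)
open import Data.Product using (_×_)
open import Relation.Binary.PropositionalEquality using (_≡_; _≢_)

import Data.Nat as ℕ
import Data.Nat.Properties as ℕP
import Data.Integer as ℤ
open import Data.Integer.Properties using (*-zeroˡ)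
open import Data.Vec as V using (_∷_; take; drop; cast)
open import Data.Vec.Properties using (≡-dec; ∷-injective)
open import Data.List.Relation.Unary.All using (_∷_)
open import Data.Product using (_,_; proj₁; proj₂)
open import Relation.Binary.PropositionalEquality using (refl; sym; trans; cong)
open import Relation.Nullary using (¬_; Dec; yes; no; does; contradiction)
open import Data.Bool using (if_then_else_)

δ : ∀ {P : Set} → Dec P → ℤ
δ d = if does d then + 1 else + 0

δ-false : ∀ {P : Set} (d : Dec P) → ¬ P → δ d ≡ + 0
δ-false (yes p) ¬p = contradiction p ¬p
δ-false (no _)  _  = refl

δ-cong : ∀ {P Q : Set} → (P → Q) → (Q → P) → (d : Dec P) (d′ : Dec Q) → δ d ≡ δ d′
δ-cong _   _   (yes _) (yes _) = refl
δ-cong _   _   (no _)  (no _)  = refl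
δ-cong p→q _   (yes p) (no ¬q) = contradiction (p→q p) ¬q
δ-cong _   q→p (no ¬p) (yes q) = contradiction (q→p q) ¬p

-- Eent j r is the
-- case a = r ∸ j, b = j (definitionally, the cast proof being irrelevant).
splitEntry : ∀ {r} (a b : ℕ) → .(r ≡ a ℕ.+ b) → Vec ℕ r → Vec ℕ r → ℤ
splitEntry a b eq m n =
  δ (≡-dec ℕ._≟_ (take a (cast eq m)) (take a (cast eq n)))
  ℤ.* eSym (drop a (cast eq m)) (drop a (cast eq n))

splitEntry-peel : ∀ {r} (a b k : ℕ) → a ≡ suc k
  → .(eq : suc r ≡ a ℕ.+ b) → .(eq′ : r ≡ k ℕ.+ b)
  → (x y : ℕ) (xs ys : Vec ℕ r)
  → (x ≢ y → splitEntry a b eq (x ∷ xs) (y ∷ ys) ≡ + 0)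
  × (x ≡ y → splitEntry a b eq (x ∷ xs) (y ∷ ys) ≡ splitEntry k b eq′ xs ys)
splitEntry-peel _ b k refl eq eq′ x y xs ys = heads-differ , heads-agree
  where
  us vs : Vec ℕ k
  us = take k (cast eq′ xs)
  vs = take k (cast eq′ ys)

  e : ℤ
  e = eSym (drop k (cast eq′ xs)) (drop k (cast eq′ ys))

  heads-differ : x ≢ y → δ (≡-dec ℕ._≟_ (x ∷ us) (y ∷ vs)) ℤ.* e ≡ + 0
  heads-differ x≢y
    rewrite δ-false (≡-dec ℕ._≟_ (x ∷ us) (y ∷ vs)) (λ p → x≢y (proj₁ (∷-injective p)))
    = *-zeroˡ e

  heads-agree : x ≡ y
    → δ (≡-dec ℕ._≟_ (x ∷ us) (y ∷ vs)) ℤ.* e ≡ δ (≡-dec ℕ._≟_ us vs) ℤ.* e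
  heads-agree refl = cong (ℤ._* e)
    (δ-cong (λ p → proj₂ (∷-injective p)) (cong (x ∷_))
            (≡-dec ℕ._≟_ (x ∷ us) (x ∷ vs)) (≡-dec ℕ._≟_ us vs))

InS-tail : ∀ {r} N x (xs : Vec ℕ r) → InS N (suc r) (x ∷ xs) → InS (N ∸ x) r xs
InS-tail N x xs (sum≡N , (_ ∷ odd≥3)) =
  trans (sym (ℕP.m+n∸m≡n x (V.sum xs))) (cong (_∸ x) sum≡N) , odd≥3

lemma4p1 : (N r' j : ℕ) → 1 ≤ N → 2 ≤ j → (j≤r' : j ≤ r')
    → (m n : Vec ℕ (suc r')) → InS N (suc r') m → InS N (suc r') n
    → (head m ≢ head n → Eent j (suc r') (m≤n⇒m≤1+n j≤r') m n ≡ + 0)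
    × (head m ≡ head n
    → InS (N ∸ head m) r' (tail m) × InS (N ∸ head n) r' (tail n)
    × Eent j (suc r') (m≤n⇒m≤1+n j≤r') m n ≡ Eent j r' j≤r' (tail m) (tail n))
lemma4p1 N r' j _ _ j≤r' (x ∷ xs) (y ∷ ys) m∈S n∈S =
  proj₁ peel , λ x≡y → InS-tail N x xs m∈S , InS-tail N y ys n∈S , proj₂ peel x≡y
  where
  -- Eent j (r'+1) has split point (r'+1) ∸ j = (r' ∸ j) + 1, and Eent j r'
  -- has split point r' ∸ j.
  peel : (x ≢ y → Eent j (suc r') (m≤n⇒m≤1+n j≤r') (x ∷ xs) (y ∷ ys) ≡ + 0)
       × (x ≡ y → Eent j (suc r') (m≤n⇒m≤1+n j≤r') (x ∷ xs) (y ∷ ys) ≡ Eent j r' j≤r' xs ys)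
  peel = splitEntry-peel (suc r' ∸ j) j (r' ∸ j) (ℕP.+-∸-assoc 1 j≤r')
           (sym (ℕP.m∸n+n≡m (m≤n⇒m≤1+n j≤r'))) (sym (ℕP.m∸n+n≡m j≤r'))
           x y xs ys
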